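{- For every connected finite simple graph $G$ one can assign positive weights to the edges of $G$ so that the resulting weighted graph is both geodetic and antipodal.
   Context: In an edge-weighted graph, the length of a path is the sum of the weights of its edges, the distance between two vertices is the minimum length of a path between them, and a geodesic is a path of minimum length. A weighted graph is geodetic if between any two vertices there is exactly one geodesic. An antipode of a vertex $v$ is a vertex at maximum (weighted) distance from $v$; a weighted graph is antipodal if it is connected and every vertex has exactly one antipode. -}

module Defs where

open import Data.Nat using (ℕ; zero; suc; _+_; _≤_; _<_)
open import Data.Fin using (Fin)
open import Data.Bool using (Bool; true; false)
open import Data.List using (List; []; _∷_; head; last)
open import Data.List.Relation.Unary.Linked using (Linked)
open import Data.List.Relation.Unary.Unique.Propositional using (Unique)
open import Data.Maybe using (just)
open import Data.Product using (Σ; _×_; ∃; ∃-syntax; _,_)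
open import Relation.Binary.PropositionalEquality using (_≡_)
open import Relation.Nullary using (¬_)

record SimpleGraph (n : ℕ) : Set where
  field
    adj   : Fin n → Fin n → Bool
    sym   : ∀ u v → adj u v ≡ adj v u
    irrefl : ∀ v → adj v v ≡ false

open SimpleGraph public

module _ {n : ℕ} (G : SimpleGraph n) where

  Adj : Fin n → Fin n → Set
  Adj u v = adj G u v ≡ true

  IsPath : Fin n → Fin n → List (Fin n) → Set
  IsPath u v p = (head p ≡ just u) × (last p ≡ just v) × Linked Adj p × Unique p

  Connected : Set
  Connected = ∀ u v → ∃[ p ] IsPath u v p

  -- An edge weighting: symmetric on edges (so it is a weight per edge)
  -- and positive on every edge. Values on non-edges are irrelevant.
  IsPositiveWeighting : (Fin n → Fin n → ℕ) → Set
  IsPositiveWeighting w = ∀ u v → Adj u v → (w u v ≡ w v u) × (0 < w u v)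

module _ {n : ℕ} (w : Fin n → Fin n → ℕ) where

  len : List (Fin n) → ℕ
  len []           = 0
  len (x ∷ [])     = 0
  len (x ∷ y ∷ xs) = w x y + len (y ∷ xs)

module _ {n : ℕ} (G : SimpleGraph n) (w : Fin n → Fin n → ℕ) where

  IsGeodesic : Fin n → Fin n → List (Fin n) → Set
  IsGeodesic u v p = IsPath G u v p × (∀ q → IsPath G u v q → len w p ≤ len w q)

  IsDist : Fin n → Fin n → ℕ → Set
  IsDist u v d = ∃[ p ] (IsGeodesic u v p × len w p ≡ d)

  Geodetic : Set
  Geodetic = ∀ u v → ∃[ p ] (IsGeodesic u v p × (∀ q → IsGeodesic u v q → q ≡ p))

  IsAntipode : Fin n → Fin n → Set
  IsAntipode v a = ∃[ d ] (IsDist v a d × (∀ x d' → IsDist v x d' → d' ≤ d))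

  Antipodal : Set
  Antipodal = Connected G × (∀ v → ∃[ a ] (IsAntipode v a × (∀ b → IsAntipode v b → b ≡ a)))

{-# OPTIONS --safe #-}
-- Number the ordered pairs of vertices injectively by c(x, y) < n² and give the edge {x, y}
-- the weight 2^c(x,y) + 2^c(y,x).  A path visits no vertex twice, so it traverses each ordered
-- pair at most once and the binary digits of its length mark exactly the pairs it traverses;
-- starting from its first vertex u the path can be read off from these digits, since u occurs
-- in no later pair.  Hence two paths with a common start and equal length coincide.  Geodesics
-- exist because there are finitely many paths; two geodesics between the same vertices have
-- equal length and so are equal, and two antipodes of v are ends of equally long geodesics
-- from v, so they are equal too.
module Submission where

open import Defs hiding (sym)
open import Data.Nat using (ℕ; zero; suc; _+_; _*_; _^_; _≤_; _<_; _≟_; _≤?_; z≤n; s≤s; NonZero)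
open import Data.Nat.Properties
open import Data.Nat.DivMod using (_%_; [m+kn]%n≡m%n; m<n⇒m%n≡m)
open import Data.Nat.Solver using (module +-*-Solver)
open import Data.Fin as Fin using (Fin; toℕ; combine)
open import Data.Fin.Properties using (toℕ<n; toℕ-injective; combine-injective; pigeonhole)
open import Data.Bool using (true)
import Data.Bool.Properties as Bool
open import Data.List using (List; []; _∷_; [_]; head; last; length; lookup; filter; allFin; cartesianProductWith)
open import Data.List.Relation.Unary.All as All using (All; []; _∷_)
open import Data.List.Relation.Unary.Any using (here; there)
open import Data.List.Relation.Unary.All.Properties using (all-filter)
open import Data.List.Relation.Unary.AllPairs using (_∷_)
open import Data.List.Relation.Unary.Linked using (linked?)
open import Data.List.Relation.Unary.Unique.Propositional using (Unique)
import Data.List.Relation.Unary.Unique.DecPropositional as UniqueDec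
open import Data.List.Membership.Propositional using (_∈_)
open import Data.List.Membership.Propositional.Properties
  using (∈-allFin; ∈-lookup; ∈-filter⁺; ∈-cartesianProductWith⁺)
open import Data.List.Extrema.Nat using (argmin; argmax; argmin-all; f[argmin]≤f[xs]; f[xs]≤f[argmax])
open import Data.Maybe using (just)
import Data.Maybe.Properties as Maybe
open import Data.Product using (_×_; ∃-syntax; _,_; proj₁; proj₂; zip′)
open import Data.Sum using (inj₁; inj₂)
open import Relation.Binary.PropositionalEquality using (_≡_; _≢_; refl; sym; trans; cong; cong₂; module ≡-Reasoning)
open import Relation.Nullary using (yes; no; contradiction)
open import Relation.Nullary.Decidable using (_×-dec_)
open import Relation.Unary using (Decidable)
open import Function using (_∘_)

private
  variable
    n : ℕ

fromBits : (ℕ → ℕ) → ℕ → ℕ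
fromBits f zero    = 0
fromBits f (suc N) = fromBits f N + f N * 2 ^ N

fromBits-+ : ∀ f g N → fromBits (λ k → f k + g k) N ≡ fromBits f N + fromBits g N
fromBits-+ f g zero    = refl
fromBits-+ f g (suc N) rewrite fromBits-+ f g N =
  solve 5 (λ a b x y p → (a :+ b) :+ (x :+ y) :* p := (a :+ x :* p) :+ (b :+ y :* p))
    refl (fromBits f N) (fromBits g N) (f N) (g N) (2 ^ N)
  where open +-*-Solver

fromBits-zero : ∀ f N → (∀ {k} → k < N → f k ≡ 0) → fromBits f N ≡ 0
fromBits-zero f zero    f≡0 = refl
fromBits-zero f (suc N) f≡0 = cong₂ _+_
  (fromBits-zero f N (λ k<N → f≡0 (m<n⇒m<1+n k<N))) (cong (_* 2 ^ N) (f≡0 (n<1+n N)))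

remainder-quotient-unique : ∀ {p x y} a b .{{_ : NonZero p}} → x < p → y < p →
                            x + a * p ≡ y + b * p → x ≡ y × a ≡ b
remainder-quotient-unique {p} {x} {y} a b x<p y<p eq =
  x≡y , *-cancelʳ-≡ a b p (+-cancelˡ-≡ y _ _ (trans (cong (_+ a * p) (sym x≡y)) eq))
  where
  open ≡-Reasoning
  x≡y : x ≡ y
  x≡y = begin
    x               ≡⟨ m<n⇒m%n≡m x<p ⟨
    x % p           ≡⟨ [m+kn]%n≡m%n x a p ⟨
    (x + a * p) % p ≡⟨ cong (_% p) eq ⟩
    (y + b * p) % p ≡⟨ [m+kn]%n≡m%n y b p ⟩
    y % p           ≡⟨ m<n⇒m%n≡m y<p ⟩
    y               ∎

fromBits<2^N : ∀ f N → (∀ k → f k ≤ 1) → fromBits f N < 2 ^ N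
fromBits<2^N f zero    bits = s≤s z≤n
fromBits<2^N f (suc N) bits = begin-strict
  fromBits f N + f N * 2 ^ N  <⟨ +-monoˡ-< (f N * 2 ^ N) (fromBits<2^N f N bits) ⟩
  2 ^ N + f N * 2 ^ N         ≤⟨ +-monoʳ-≤ (2 ^ N) (*-monoˡ-≤ (2 ^ N) (bits N)) ⟩
  2 ^ suc N                   ∎
  where open ≤-Reasoning

fromBits-injective : ∀ {f g} N → (∀ k → f k ≤ 1) → (∀ k → g k ≤ 1) →
                     fromBits f N ≡ fromBits g N → ∀ {k} → k < N → f k ≡ g k
fromBits-injective {f} {g} (suc N) f-bits g-bits eq k<1+N
  with lower≡ , top≡ ← remainder-quotient-unique (f N) (g N) {{m^n≢0 2 N}}
                         (fromBits<2^N f N f-bits) (fromBits<2^N g N g-bits) eq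
  with m<1+n⇒m<n∨m≡n k<1+N
... | inj₁ k<N  = fromBits-injective N f-bits g-bits lower≡ k<N
... | inj₂ refl = top≡

δ : ℕ → ℕ → ℕ
δ j k with j ≟ k
... | yes _ = 1
... | no  _ = 0

δ-diag : ∀ j → δ j j ≡ 1
δ-diag j with j ≟ j
... | yes _  = refl
... | no j≢j = contradiction refl j≢j

δ-off : ∀ {j k} → j ≢ k → δ j k ≡ 0
δ-off {j} {k} j≢k with j ≟ k
... | yes j≡k = contradiction j≡k j≢k
... | no  _   = refl

fromBits-δ : ∀ {j} N → j < N → fromBits (δ j) N ≡ 2 ^ j
fromBits-δ {j} (suc N) j<1+N with m<1+n⇒m<n∨m≡n j<1+N
... | inj₁ j<N rewrite fromBits-δ N j<N | δ-off (<⇒≢ j<N) = +-identityʳ (2 ^ j)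
... | inj₂ refl rewrite fromBits-zero (δ j) j (λ k<j → δ-off (>⇒≢ k<j)) | δ-diag j = +-identityʳ (2 ^ j)

pairCode : Fin n → Fin n → ℕ
pairCode x y = toℕ (combine x y)

pairCode< : ∀ (x y : Fin n) → pairCode x y < n * n
pairCode< x y = toℕ<n (combine x y)

pairCode-injective : ∀ {x y a b : Fin n} → pairCode x y ≡ pairCode a b → x ≡ a × y ≡ b
pairCode-injective {x = x} {y} {a} {b} eq = combine-injective x y a b (toℕ-injective eq)

binaryWeight : Fin n → Fin n → ℕ
binaryWeight x y = 2 ^ pairCode x y + 2 ^ pairCode y x

edgeBits : Fin n → Fin n → ℕ → ℕ
edgeBits x y k = δ (pairCode x y) k + δ (pairCode y x) k

pairCount : List (Fin n) → ℕ → ℕ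
pairCount (x ∷ y ∷ p) k = edgeBits x y k + pairCount (y ∷ p) k
pairCount _           k = 0

fromBits-edgeBits : ∀ (x y : Fin n) → fromBits (edgeBits x y) (n * n) ≡ binaryWeight x y
fromBits-edgeBits {n} x y = trans (fromBits-+ (δ (pairCode x y)) (δ (pairCode y x)) (n * n))
  (cong₂ _+_ (fromBits-δ (n * n) (pairCode< x y)) (fromBits-δ (n * n) (pairCode< y x)))

len≡fromBits-pairCount : ∀ (p : List (Fin n)) → len binaryWeight p ≡ fromBits (pairCount p) (n * n)
len≡fromBits-pairCount {n} []          = sym (fromBits-zero (pairCount {n} []) (n * n) (λ _ → refl))
len≡fromBits-pairCount {n} (x ∷ [])    = sym (fromBits-zero (pairCount [ x ]) (n * n) (λ _ → refl))
len≡fromBits-pairCount {n} (x ∷ y ∷ p) = sym (begin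
  fromBits (pairCount (x ∷ y ∷ p)) (n * n)
    ≡⟨ fromBits-+ (edgeBits x y) (pairCount (y ∷ p)) (n * n) ⟩
  fromBits (edgeBits x y) (n * n) + fromBits (pairCount (y ∷ p)) (n * n)
    ≡⟨ cong₂ _+_ (fromBits-edgeBits x y) (sym (len≡fromBits-pairCount (y ∷ p))) ⟩
  binaryWeight x y + len binaryWeight (y ∷ p) ∎)
  where open ≡-Reasoning

edgeBits-avoiding : ∀ {x a b : Fin n} → x ≢ a → x ≢ b → ∀ z →
                    edgeBits a b (pairCode x z) ≡ 0 × edgeBits a b (pairCode z x) ≡ 0
edgeBits-avoiding x≢a x≢b z =
  cong₂ _+_ (δ-off (λ eq → x≢a (sym (proj₁ (pairCode-injective eq)))))
            (δ-off (λ eq → x≢b (sym (proj₁ (pairCode-injective eq))))) ,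
  cong₂ _+_ (δ-off (λ eq → x≢b (sym (proj₂ (pairCode-injective eq)))))
            (δ-off (λ eq → x≢a (sym (proj₂ (pairCode-injective eq)))))

pairCount-avoiding : ∀ {x : Fin n} p → All (x ≢_) p → ∀ z →
                     pairCount p (pairCode x z) ≡ 0 × pairCount p (pairCode z x) ≡ 0
pairCount-avoiding []          _                        z = refl , refl
pairCount-avoiding (_ ∷ [])    _                        z = refl , refl
pairCount-avoiding (a ∷ b ∷ p) (x≢a ∷ x∉p@(x≢b ∷ _)) z =
  zip′ (cong₂ _+_) (cong₂ _+_) (edgeBits-avoiding x≢a x≢b z) (pairCount-avoiding (b ∷ p) x∉p z)

pairCount≤1 : ∀ (p : List (Fin n)) → Unique p → ∀ k → pairCount p k ≤ 1
pairCount≤1 []          _                      k = z≤n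
pairCount≤1 (_ ∷ [])    _                      k = z≤n
pairCount≤1 (x ∷ y ∷ p) (x∉yp@(x≢y ∷ _) ∷ unique) k with k ≟ pairCode x y | k ≟ pairCode y x
... | yes refl | _ = ≤-reflexive (cong₂ _+_
      (cong₂ _+_ (δ-diag (pairCode x y)) (δ-off (λ eq → x≢y (proj₂ (pairCode-injective eq)))))
      (proj₁ (pairCount-avoiding (y ∷ p) x∉yp y)))
... | no _ | yes refl = ≤-reflexive (cong₂ _+_
      (cong₂ _+_ (δ-off (λ eq → x≢y (proj₁ (pairCode-injective eq)))) (δ-diag (pairCode y x)))
      (proj₂ (pairCount-avoiding (y ∷ p) x∉yp y)))
... | no k≢xy | no k≢yx = ≤-trans
      (≤-reflexive (cong (_+ pairCount (y ∷ p) k) (cong₂ _+_ (δ-off (k≢xy ∘ sym)) (δ-off (k≢yx ∘ sym)))))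
      (pairCount≤1 (y ∷ p) unique k)

pairCount-first : ∀ (u x : Fin n) p → 0 < pairCount (u ∷ x ∷ p) (pairCode u x)
pairCount-first u x p =
  ≤-trans (≤-reflexive (sym (δ-diag (pairCode u x)))) (≤-trans (m≤m+n _ _) (m≤m+n _ _))

pairCount-elsewhere : ∀ {u x y : Fin n} {q} → All (u ≢_) (y ∷ q) → x ≢ y →
                      pairCount (u ∷ y ∷ q) (pairCode u x) ≡ 0
pairCount-elsewhere {u = u} {x} {y} {q} u∉yq@(u≢y ∷ _) x≢y = cong₂ _+_
  (cong₂ _+_ (δ-off (λ eq → x≢y (sym (proj₂ (pairCode-injective eq)))))
             (δ-off (λ eq → u≢y (sym (proj₁ (pairCode-injective eq))))))
  (proj₁ (pairCount-avoiding (y ∷ q) u∉yq x))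

pairCount-injective : ∀ {u : Fin n} p q → Unique (u ∷ p) → Unique (u ∷ q) →
                      (∀ {k} → k < n * n → pairCount (u ∷ p) k ≡ pairCount (u ∷ q) k) → p ≡ q
pairCount-injective []      []      _ _ same = refl
pairCount-injective {u = u} []      (y ∷ q) _ _ same =
  contradiction (sym (same (pairCode< u y))) (>⇒≢ (pairCount-first u y q))
pairCount-injective {u = u} (x ∷ p) []      _ _ same =
  contradiction (same (pairCode< u x)) (>⇒≢ (pairCount-first u x p))
pairCount-injective {u = u} (x ∷ p) (y ∷ q) (_ ∷ unique-p) (u∉yq ∷ unique-q) same with x Fin.≟ y
... | yes refl = cong (x ∷_) (pairCount-injective p q unique-p unique-q
                   (λ {k} k< → +-cancelˡ-≡ (edgeBits u x k) _ _ (same k<)))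
... | no x≢y   = contradiction (trans (same (pairCode< u x)) (pairCount-elsewhere u∉yq x≢y))
                   (>⇒≢ (pairCount-first u x p))

len-binaryWeight-injective : ∀ {u : Fin n} p q → Unique (u ∷ p) → Unique (u ∷ q) →
                             len binaryWeight (u ∷ p) ≡ len binaryWeight (u ∷ q) → p ≡ q
len-binaryWeight-injective {n} {u} p q unique-p unique-q eq =
  pairCount-injective p q unique-p unique-q
    (fromBits-injective (n * n) (pairCount≤1 (u ∷ p) unique-p) (pairCount≤1 (u ∷ q) unique-q)
      (trans (sym (len≡fromBits-pairCount (u ∷ p))) (trans eq (len≡fromBits-pairCount (u ∷ q)))))

Unique⇒lookup-injective : ∀ {A : Set} {xs : List A} → Unique xs →
                          ∀ {i j} → toℕ i < toℕ j → lookup xs i ≢ lookup xs j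
Unique⇒lookup-injective (x∉xs ∷ _)      {Fin.zero}  {Fin.suc j} _         = All.lookup x∉xs (∈-lookup j)
Unique⇒lookup-injective (_ ∷ unique-xs) {Fin.suc i} {Fin.suc j} (s≤s i<j) =
  Unique⇒lookup-injective unique-xs i<j

Unique⇒length≤ : ∀ {xs : List (Fin n)} → Unique xs → length xs ≤ n
Unique⇒length≤ {n} {xs} unique-xs with length xs ≤? n
... | yes ≤n = ≤n
... | no  ≰n with i , j , i<j , eq ← pigeonhole (≰⇒> ≰n) (lookup xs) =
  contradiction eq (Unique⇒lookup-injective unique-xs i<j)

listsUpTo : ℕ → List (List (Fin n))
listsUpTo zero    = [ [] ]
listsUpTo (suc m) = [] ∷ cartesianProductWith _∷_ (allFin _) (listsUpTo m)

∈-listsUpTo : ∀ {m} (xs : List (Fin n)) → length xs ≤ m → xs ∈ listsUpTo m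
∈-listsUpTo {m = zero}  []       _         = here refl
∈-listsUpTo {m = suc m} []       _         = here refl
∈-listsUpTo {m = suc m} (x ∷ xs) (s≤s len≤) =
  there (∈-cartesianProductWith⁺ _∷_ (∈-allFin x) (∈-listsUpTo xs len≤))

module _ (G : SimpleGraph n) where

  isPath? : ∀ u v → Decidable (IsPath G u v)
  isPath? u v p =
    Maybe.≡-dec Fin._≟_ (head p) (just u) ×-dec
    Maybe.≡-dec Fin._≟_ (last p) (just v) ×-dec
    linked? (λ x y → adj G x y Bool.≟ true) p ×-dec
    UniqueDec.unique? Fin._≟_ p

  paths : Fin n → Fin n → List (List (Fin n))
  paths u v = filter (isPath? u v) (listsUpTo n)

  ∈-paths : ∀ {u v p} → IsPath G u v p → p ∈ paths u v
  ∈-paths path@(_ , _ , _ , unique) = ∈-filter⁺ (isPath? _ _) (∈-listsUpTo _ (Unique⇒length≤ unique)) path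

  IsPath-end-unique : ∀ {u u′ v v′ p q} → IsPath G u v p → IsPath G u′ v′ q → p ≡ q → v ≡ v′
  IsPath-end-unique (_ , last≡v , _) (_ , last≡v′ , _) refl =
    Maybe.just-injective (trans (sym last≡v) last≡v′)

  module _ (w : Fin n → Fin n → ℕ) where

    PathLengthInjective : Set
    PathLengthInjective = ∀ {u v v′ p q} → IsPath G u v p → IsPath G u v′ q → len w p ≡ len w q → p ≡ q

    geodesic : Connected G → ∀ u v → ∃[ p ] IsGeodesic G w u v p
    geodesic connected u v with p₀ , path₀ ← connected u v =
      argmin (len w) p₀ (paths u v) ,
      argmin-all (len w) path₀ (all-filter (isPath? u v) (listsUpTo n)) ,
      λ q path-q → All.lookup (f[argmin]≤f[xs] {f = len w} p₀ (paths u v)) (∈-paths path-q)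

    geodesic-len-unique : ∀ {u v p q} → IsGeodesic G w u v p → IsGeodesic G w u v q → len w p ≡ len w q
    geodesic-len-unique (path-p , shortest-p) (path-q , shortest-q) =
      ≤-antisym (shortest-p _ path-q) (shortest-q _ path-p)

    geodetic : Connected G → PathLengthInjective → Geodetic G w
    geodetic connected injective u v with p , geo-p ← geodesic connected u v =
      p , geo-p , λ q geo-q → injective (proj₁ geo-q) (proj₁ geo-p) (geodesic-len-unique geo-q geo-p)

    antipodal : Connected G → PathLengthInjective → Antipodal G w
    antipodal connected injective = connected , antipode
      where
      dist : Fin n → Fin n → ℕ
      dist v x = len w (proj₁ (geodesic connected v x))

      dist-isDist : ∀ v x → IsDist G w v x (dist v x)
      dist-isDist v x = proj₁ (geodesic connected v x) , proj₂ (geodesic connected v x) , refl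

      isDist⇒≡dist : ∀ {v x d} → IsDist G w v x d → d ≡ dist v x
      isDist⇒≡dist {v} {x} (p , geo-p , refl) = geodesic-len-unique geo-p (proj₂ (geodesic connected v x))

      antipode : ∀ v → ∃[ a ] (IsAntipode G w v a × (∀ b → IsAntipode G w v b → b ≡ a))
      antipode v = a , (dist v a , dist-isDist v a , farthest) , unique
        where
        a : Fin n
        a = argmax (dist v) v (allFin n)

        farthest : ∀ x d → IsDist G w v x d → d ≤ dist v a
        farthest x d isDist = ≤-trans (≤-reflexive (isDist⇒≡dist isDist))
          (All.lookup (f[xs]≤f[argmax] {f = dist v} v (allFin n)) (∈-allFin x))

        unique : ∀ b → IsAntipode G w v b → b ≡ a
        unique b (d , isDist@(p , (path-p , _) , refl) , maximal) =
          IsPath-end-unique path-p path-γ p≡γ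
          where
          path-γ : IsPath G v a (proj₁ (geodesic connected v a))
          path-γ = proj₁ (proj₂ (geodesic connected v a))
          p≡γ : p ≡ proj₁ (geodesic connected v a)
          p≡γ = injective path-p path-γ
                  (≤-antisym (farthest b d isDist) (maximal a (dist v a) (dist-isDist v a)))

binaryWeight-positive : (G : SimpleGraph n) → IsPositiveWeighting G binaryWeight
binaryWeight-positive G u v _ =
  +-comm (2 ^ pairCode u v) (2 ^ pairCode v u) , <-≤-trans (m^n>0 2 (pairCode u v)) (m≤m+n _ _)

binaryWeight-pathLengthInjective : (G : SimpleGraph n) → PathLengthInjective G binaryWeight
binaryWeight-pathLengthInjective G {p = []}    {q}         (() , _)
binaryWeight-pathLengthInjective G {p = _ ∷ _} {q = []}    _        (() , _)
binaryWeight-pathLengthInjective G {p = u ∷ p} {q = _ ∷ q} (refl , _ , _ , unique-p) (refl , _ , _ , unique-q) eq =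
  cong (u ∷_) (len-binaryWeight-injective p q unique-p unique-q eq)

theorem7 : (n : ℕ) (G : SimpleGraph n) → Connected G →
           ∃[ w ] (IsPositiveWeighting G w × Geodetic G w × Antipodal G w)
theorem7 n G connected =
  binaryWeight ,
  binaryWeight-positive G ,
  geodetic G binaryWeight connected (binaryWeight-pathLengthInjective G) ,
  antipodal G binaryWeight connected (binaryWeight-pathLengthInjective G)
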